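{- Let $G$ be a graph in the support of $\mathcal{D}_{\mathrm{perm}}$ with blue set $B$, and consider any sequence of queries to distinct vertices. Fix $q$ and a blue vertex $u\in\mathrm{KG}_q[B]$, and let $A_0(u),A_1(u),\dots,A_{H_q(u)}(u)$ be its closure sequence. Then \[ A_{H_q(u)}(u)=\mathrm{Anc}_q(u). \] In particular, if $D\ge 1$ is such that $|\mathrm{Anc}_{F_q}(v)|\le D$ for every blue vertex $v\in\mathrm{KG}_q[B]$, then \[ |\mathrm{Anc}_q(u)|\le 1+H_q(u)\cdot D\le (H_q(u)+1)\cdot D. \]
   Context: $\mathcal{D}_{\mathrm{perm}}$ is a distribution on digraphs whose vertex set is partitioned into a blue set $B$ and red layers; blue vertices $u$ have blue out-edges $u\to\pi_j(u)$ for permutations $\pi_1,\dots,\pi_{d_B}$ of $B$ plus red out-edges, and there are no red-to-blue edges. For a vertex $x$, $\Gamma^+(x)$ is its outneighbor list and $\Gamma^+_B(x)=\Gamma^+(x)\cap B$. A query to $x$ reveals $\Gamma^+(x)$. After $q$ queries, $\mathrm{KG}_q$ is the knowledge graph formed by queried vertices, revealed outneighbors and revealed edges, $S_q$ its vertex set, and $\mathrm{KG}_q[B]$ its subgraph induced on blue vertices. $\mathrm{Anc}_q(u)$ is the set of blue vertices that can reach $u$ by a directed path (possibly of length $0$) in $\mathrm{KG}_q[B]$. A blue surprise edge revealed at time $t$ is a revealed blue edge $x\to y$ where $x$ is queried at time $t$ and $y\in S_{t-1}$. $F_q$ is $\mathrm{KG}_q[B]$ with all blue surprise edges (revealed at times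 $\le q$) removed, and $\mathrm{Anc}_{F_q}(v)$ is the set of blue vertices that can reach $v$ in $F_q$ (including $v$). Closure sequence: $A_0(u)=\{u\}$; for $i\ge1$, if there exists a queried blue vertex $x\in\mathrm{KG}_q[B]\setminus A_{i-1}(u)$ with $\Gamma^+_B(x)\cap A_{i-1}(u)\neq\emptyset$, let $x_i$ be such an $x$ with smallest query time and $A_i(u)=A_{i-1}(u)\cup\mathrm{Anc}_{F_q}(x_i)$; stop when no such $x$ exists. $H_q(u)$ is the number of steps performed. -}

module Defs where

open import Data.Nat using (ℕ; zero; suc; _<_; _≤_)
open import Data.Fin using (Fin; toℕ)
open import Data.Fin.Subset using (Subset; _∈_; _∉_)
open import Data.Fin.Subset.Properties using (_∈?_)
open import Data.List using (List; filter; tabulate)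
import Data.List.Membership.Propositional as LM
open import Data.List.Relation.Binary.Permutation.Propositional using (_↭_)
open import Data.Product using (Σ; ∃; _×_)
open import Data.Sum using (_⊎_)
open import Function.Bundles using (_⇔_)
open import Relation.Binary.PropositionalEquality using (_≡_)
open import Relation.Binary.Construct.Closure.ReflexiveTransitive using (Star)
open import Relation.Nullary using (¬_)

-- A digraph on vertex set Fin n: a blue set B (the red vertices are the
-- complement) and, for every vertex, its outneighbor list Γ⁺(x).
record Digraph (n : ℕ) : Set where
  field
    B : Subset n
    Γ : Fin n → List (Fin n)

IsPermOf : ∀ {n} → Subset n → (Fin n → Fin n) → Set
IsPermOf B π =
  (∀ u → u ∈ B → π u ∈ B) ×
  (∀ u v → u ∈ B → v ∈ B → π u ≡ π v → u ≡ v) ×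
  (∀ v → v ∈ B → ∃ λ u → u ∈ B × π u ≡ v)

ΓB : ∀ {n} → Digraph n → Fin n → List (Fin n)
ΓB G x = filter (_∈? Digraph.B G) (Digraph.Γ G x)

-- Support of D_perm (blue part): there are permutations π₁..π_{d_B} of B
-- such that the blue out-edges of a blue u are exactly u → π_j(u), and
-- there are no red-to-blue edges.
InSupportPerm : ∀ {n} → Digraph n → Set
InSupportPerm {n} G =
  Σ ℕ λ dB → Σ (Fin dB → Fin n → Fin n) λ π →
    (∀ j → IsPermOf B (π j)) ×
    (∀ u → u ∈ B → ΓB G u ↭ tabulate (λ j → π j u)) ×
    (∀ x → x ∉ B → ∀ y → y LM.∈ Γ x → y ∉ B)
  where open Digraph G

Represents : ∀ {n} → Subset n → (Fin n → Set) → Set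
Represents {n} S P = ∀ (v : Fin n) → (v ∈ S) ⇔ P v

-- Knowledge-graph notions after q queries, for a query sequence
-- qs : Fin T → Fin n (query at 0-based index t happens at time toℕ t + 1).
module KG {n : ℕ} (G : Digraph n) {T : ℕ} (qs : Fin T → Fin n) where
  open Digraph G

  -- S_k : vertex set of KG_k (queried vertices and revealed outneighbors).
  S : ℕ → Fin n → Set
  S k v = ∃ λ (s : Fin T) → toℕ s < k × (qs s ≡ v ⊎ v LM.∈ Γ (qs s))

  InKGB : ℕ → Fin n → Set
  InKGB q v = v ∈ B × S q v

  EdgeKGB : ℕ → Fin n → Fin n → Set
  EdgeKGB q x y = ∃ λ (t : Fin T) → toℕ t < q × qs t ≡ x ×
                  x ∈ B × y ∈ B × y LM.∈ Γ x

  -- blue surprise edge x → y revealed at (0-based) query index t: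
  -- x queried at time toℕ t + 1 and y ∈ S_{toℕ t}.
  SurpriseAt : Fin T → Fin n → Fin n → Set
  SurpriseAt t x y = qs t ≡ x × x ∈ B × y ∈ B × y LM.∈ Γ x × S (toℕ t) y

  EdgeF : ℕ → Fin n → Fin n → Set
  EdgeF q x y = ∃ λ (t : Fin T) → toℕ t < q × qs t ≡ x ×
                x ∈ B × y ∈ B × y LM.∈ Γ x × ¬ SurpriseAt t x y

  Anc : ℕ → Fin n → Fin n → Set
  Anc q u v = v ∈ B × Star (EdgeKGB q) v u

  AncF : ℕ → Fin n → Fin n → Set
  AncF q x v = v ∈ B × Star (EdgeF q) v x

  Candidate : ℕ → Subset n → Fin T → Set
  Candidate q A t = toℕ t < q × qs t ∈ B × qs t ∉ A ×
                    ∃ λ y → y LM.∈ Γ (qs t) × y ∈ B × y ∈ A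

  ClosureStep : ℕ → Subset n → Subset n → Set
  ClosureStep q A A' = ∃ λ (t : Fin T) → Candidate q A t ×
    (∀ s → Candidate q A s → toℕ t ≤ toℕ s) ×
    Represents A' (λ v → v ∈ A ⊎ AncF q (qs t) v)

  IsClosureSeq : ℕ → Fin n → ℕ → (ℕ → Subset n) → Set
  IsClosureSeq q u H A =
    Represents (A 0) (λ v → v ≡ u) ×
    (∀ i → i < H → ClosureStep q (A i) (A (suc i))) ×
    (∀ s → ¬ Candidate q (A H) s)

-- A vertex v that reaches u in KG_q[B] is added by the closure process: if
-- the final set A_H missed some ancestor of u, then along its path to u there
-- would be a revealed edge x → y with x ∉ A_H and y ∈ A_H, and x would be a
-- candidate, contradicting termination. Conversely everything added reaches u,
-- because Anc_F(x_i) reaches x_i inside KG_q[B] and x_i has an edge into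
-- A_{i-1}. Each step adds at most |Anc_F(x_i)| ≤ D vertices, which gives the
-- size bound.
module Submission where

open import Defs
open import Data.Bool using (Bool)
open import Data.Bool.Properties using (T-≡)
open import Data.Empty using (⊥-elim)
open import Data.Fin using (Fin; toℕ; _≟_)
open import Data.Fin.Properties using (any?)
open import Data.Fin.Subset
  using (Subset; ∣_∣; _∈_; _⊆_; _⊂_; _∪_; ⁅_⁆; inside; outside)
open import Data.Fin.Subset.Properties
  using (_∈?_; ∣p∣≤n; p⊂q⇒∣p∣<∣q∣; ⊆-antisym; ∣⁅x⁆∣≡1; x∈⁅y⁆⇔x≡y; ∪⇔⊎)
import Data.List.Membership.DecPropositional as ListMembership
open import Data.Nat using (ℕ; zero; suc; _+_; _*_; _≤_; z≤n; s≤s; _<?_)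
open import Data.Nat.GeneralisedArithmetic using (iterate)
open import Data.Nat.Properties
  using (≤-trans; ≤-refl; ≤-reflexive; <⇒≤; <⇒≱; +-comm; +-suc; +-monoˡ-≤; +-monoʳ-≤;
         m≤m+n; n≤1+n; *-distribʳ-+; *-identityˡ; module ≤-Reasoning)
open import Data.Product using (∃; _×_; _,_; proj₁; proj₂)
open import Data.Sum using (_⊎_; inj₁; inj₂)
import Data.Sum as Sum
open import Data.Vec using ([]; _∷_; tabulate)
open import Data.Vec.Properties using (lookup∘tabulate; []=⇒lookup; lookup⇒[]=)
open import Function.Base using (_∘_; id)
open import Function.Bundles using (mk⇔; Equivalence)
open import Function.Definitions using (Injective)
import Relation.Binary.Definitions as Binary
open import Relation.Binary.PropositionalEquality using (_≡_; refl; sym; trans; cong)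
open import Relation.Binary.Construct.Closure.ReflexiveTransitive
  using (Star; ε; _◅_; _◅◅_; gmap)
open import Relation.Nullary using (¬_; Dec; yes; no)
open import Relation.Nullary.Decidable
  using (isYes; map′; _×-dec_; _⊎-dec_; ¬?; toWitness; fromWitness; decidable-stable)
open import Relation.Unary using (Decidable)

open Equivalence using (to; from)

module _ {n : ℕ} where

  fromDecidable : {P : Fin n → Set} → Decidable P → Subset n
  fromDecidable P? = tabulate (λ v → isYes (P? v))

  fromDecidable-represents : {P : Fin n → Set} (P? : Decidable P) →
                             Represents (fromDecidable P?) P
  fromDecidable-represents P? v = mk⇔
    (λ v∈ → toWitness {a? = P? v} (from T-≡ (trans (sym (lookup∘tabulate f v)) ([]=⇒lookup v∈))))
    (λ Pv → lookup⇒[]= v _ (trans (lookup∘tabulate f v) (to T-≡ (fromWitness {a? = P? v} Pv))))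
    where
    f : Fin n → Bool
    f v = isYes (P? v)

  Represents-unique : ∀ {S S′ : Subset n} {P : Fin n → Set} →
                      Represents S P → Represents S′ P → S ≡ S′
  Represents-unique S≈P S′≈P = ⊆-antisym
    (λ {v} v∈S → from (S′≈P v) (to (S≈P v) v∈S))
    (λ {v} v∈S′ → from (S≈P v) (to (S′≈P v) v∈S′))

  ∪-represents : ∀ {X R : Subset n} {P : Fin n → Set} →
                 Represents R P → Represents (X ∪ R) (λ v → v ∈ X ⊎ P v)
  ∪-represents R≈P v = mk⇔
    (Sum.map₂ (to (R≈P v)) ∘ to ∪⇔⊎)
    (from ∪⇔⊎ ∘ Sum.map₂ (from (R≈P v)))

∣p∪q∣≤∣p∣+∣q∣ : ∀ {n} (p q : Subset n) → ∣ p ∪ q ∣ ≤ ∣ p ∣ + ∣ q ∣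
∣p∪q∣≤∣p∣+∣q∣ []            []            = z≤n
∣p∪q∣≤∣p∣+∣q∣ (inside ∷ p)  (inside ∷ q)  =
  s≤s (≤-trans (∣p∪q∣≤∣p∣+∣q∣ p q) (+-monoʳ-≤ ∣ p ∣ (n≤1+n ∣ q ∣)))
∣p∪q∣≤∣p∣+∣q∣ (inside ∷ p)  (outside ∷ q) = s≤s (∣p∪q∣≤∣p∣+∣q∣ p q)
∣p∪q∣≤∣p∣+∣q∣ (outside ∷ p) (inside ∷ q)  =
  ≤-trans (s≤s (∣p∪q∣≤∣p∣+∣q∣ p q)) (≤-reflexive (sym (+-suc ∣ p ∣ ∣ q ∣)))
∣p∪q∣≤∣p∣+∣q∣ (outside ∷ p) (outside ∷ q) = ∣p∪q∣≤∣p∣+∣q∣ p q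

iterate-preserves : ∀ {A : Set} (I : A → Set) (f : A → A) →
                    (∀ {X} → I X → I (f X)) → ∀ {X} k → I X → I (iterate f X k)
iterate-preserves I f pres zero    I-X = I-X
iterate-preserves I f pres (suc k) I-X = iterate-preserves I f pres k (pres I-X)

module _ {n : ℕ} (f : Subset n → Subset n) (inflationary : ∀ X → X ⊆ f X) where

  stable-or-grows : ∀ X → f X ⊆ X ⊎ X ⊂ f X
  stable-or-grows X with any? (λ v → v ∈? f X ×-dec ¬? (v ∈? X))
  ... | yes (v , v∈fX , v∉X) = inj₂ (inflationary X , v , v∈fX , v∉X)
  ... | no noNew = inj₁ λ {v} v∈fX →
    decidable-stable (v ∈? X) (λ v∉X → noNew (v , v∈fX , v∉X))

  iterate-stabilises-within : ∀ m X → n ≤ m + ∣ X ∣ →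
                              ∃ λ k → f (iterate f X k) ⊆ iterate f X k
  iterate-stabilises-within m X n≤m+∣X∣ with stable-or-grows X
  iterate-stabilises-within m X n≤m+∣X∣ | inj₁ stable = 0 , stable
  iterate-stabilises-within zero X n≤∣X∣ | inj₂ X⊂fX =
    ⊥-elim (<⇒≱ (p⊂q⇒∣p∣<∣q∣ X⊂fX) (≤-trans (∣p∣≤n (f X)) n≤∣X∣))
  iterate-stabilises-within (suc m) X n≤1+m+∣X∣ | inj₂ X⊂fX =
    let k , stable = iterate-stabilises-within m (f X) n≤m+∣fX∣ in suc k , stable
    where
    n≤m+∣fX∣ : n ≤ m + ∣ f X ∣
    n≤m+∣fX∣ = ≤-trans n≤1+m+∣X∣
      (≤-trans (≤-reflexive (sym (+-suc m ∣ X ∣))) (+-monoʳ-≤ m (p⊂q⇒∣p∣<∣q∣ X⊂fX)))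

  iterate-stabilises : ∀ X → ∃ λ k → f (iterate f X k) ⊆ iterate f X k
  iterate-stabilises X = iterate-stabilises-within n X (m≤m+n n ∣ X ∣)

module _ {n : ℕ} {E : Fin n → Fin n → Set} (E? : Binary.Decidable E) where

  withPredecessors : Subset n → Subset n
  withPredecessors X =
    fromDecidable (λ v → v ∈? X ⊎-dec any? (λ w → E? v w ×-dec w ∈? X))

  withPredecessors-represents : ∀ X →
    Represents (withPredecessors X) (λ v → v ∈ X ⊎ ∃ λ w → E v w × w ∈ X)
  withPredecessors-represents X = fromDecidable-represents _

  withPredecessors-inflationary : ∀ X → X ⊆ withPredecessors X
  withPredecessors-inflationary X {v} v∈X =
    from (withPredecessors-represents X v) (inj₁ v∈X)

  Star-decidable : Binary.Decidable (Star E)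
  Star-decidable v x = map′ (reaches k) complete (v ∈? R)
    where
    stabilisation : ∃ λ k → withPredecessors (iterate withPredecessors ⁅ x ⁆ k)
                              ⊆ iterate withPredecessors ⁅ x ⁆ k
    stabilisation = iterate-stabilises withPredecessors withPredecessors-inflationary ⁅ x ⁆

    k : ℕ
    k = proj₁ stabilisation

    R : Subset n
    R = iterate withPredecessors ⁅ x ⁆ k

    ReachesX : Subset n → Set
    ReachesX X = ∀ {v} → v ∈ X → Star E v x

    reaches : ∀ k → ReachesX (iterate withPredecessors ⁅ x ⁆ k)
    reaches k = iterate-preserves ReachesX withPredecessors step k base
      where
      base : ReachesX ⁅ x ⁆
      base v∈⁅x⁆ with to x∈⁅y⁆⇔x≡y v∈⁅x⁆
      ... | refl = ε

      step : ∀ {X} → ReachesX X → ReachesX (withPredecessors X)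
      step {X} reach {v} v∈ with to (withPredecessors-represents X v) v∈
      ... | inj₁ v∈X           = reach v∈X
      ... | inj₂ (w , e , w∈X) = e ◅ reach w∈X

    complete : ∀ {v} → Star E v x → v ∈ R
    complete ε       = iterate-preserves (x ∈_) withPredecessors
                         (withPredecessors-inflationary _) k (from x∈⁅y⁆⇔x≡y refl)
    complete {v} (e ◅ p) =
      proj₂ stabilisation (from (withPredecessors-represents R v) (inj₂ (_ , e , complete p)))

module _ {n : ℕ} (G : Digraph n) {T : ℕ} (qs : Fin T → Fin n) where
  open Digraph G
  open KG G qs
  open ListMembership (_≟_ {n}) using () renaming (_∈?_ to _∈ᴸ?_)

  S? : ∀ k y → Dec (S k y)
  S? k y = any? (λ s → toℕ s <? k ×-dec (qs s ≟ y ⊎-dec y ∈ᴸ? Γ (qs s)))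

  SurpriseAt? : ∀ t x y → Dec (SurpriseAt t x y)
  SurpriseAt? t x y =
    qs t ≟ x ×-dec x ∈? B ×-dec y ∈? B ×-dec y ∈ᴸ? Γ x ×-dec S? (toℕ t) y

  EdgeF? : ∀ q → Binary.Decidable (EdgeF q)
  EdgeF? q x y = any? λ t →
    toℕ t <? q ×-dec qs t ≟ x ×-dec x ∈? B ×-dec y ∈? B ×-dec y ∈ᴸ? Γ x ×-dec
    ¬? (SurpriseAt? t x y)

  -- The size hypothesis only constrains subsets that represent Anc_F, so one
  -- must be constructed; this is why reachability in F_q is decided above.
  AncF-representable : ∀ q x → ∃ λ R → Represents R (AncF q x)
  AncF-representable q x = _ , fromDecidable-represents AncF?
    where
    AncF? : Decidable (AncF q x)
    AncF? v = v ∈? B ×-dec Star-decidable (EdgeF? q) v x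

  AncF-boundedBy : ℕ → ℕ → Set
  AncF-boundedBy q D =
    ∀ v → InKGB q v → ∀ S → Represents S (AncF q v) → ∣ S ∣ ≤ D

  module _ {q : ℕ} where

    EdgeF⇒EdgeKGB : ∀ {x y} → EdgeF q x y → EdgeKGB q x y
    EdgeF⇒EdgeKGB (t , t<q , qt≡x , x∈B , y∈B , y∈Γx , _) = t , t<q , qt≡x , x∈B , y∈B , y∈Γx

    closureStep-⊆ : ∀ {X Y} → ClosureStep q X Y → X ⊆ Y
    closureStep-⊆ (_ , _ , _ , Y≈) {v} v∈X = from (Y≈ v) (inj₁ v∈X)

    closureStep-preserves-Anc : ∀ {u X Y} → ClosureStep q X Y →
      (∀ {v} → v ∈ X → Anc q u v) → ∀ {v} → v ∈ Y → Anc q u v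
    closureStep-preserves-Anc (t , (t<q , x∈B , _ , y , y∈Γx , y∈B , y∈X) , _ , Y≈) X⊆Anc {v} v∈Y
      with to (Y≈ v) v∈Y
    ... | inj₁ v∈X          = X⊆Anc v∈X
    ... | inj₂ (v∈B , v↝x) =
      v∈B , gmap id EdgeF⇒EdgeKGB v↝x ◅◅ x→y ◅ proj₂ (X⊆Anc y∈X)
      where x→y = t , t<q , refl , x∈B , y∈B , y∈Γx

    closureStep-∣∣≤ : ∀ {D X Y} → AncF-boundedBy q D → ClosureStep q X Y → ∣ Y ∣ ≤ ∣ X ∣ + D
    closureStep-∣∣≤ {D} {X} {Y} bounded (t , (t<q , x∈B , _) , _ , Y≈) = begin
      ∣ Y ∣          ≡⟨ cong ∣_∣ (Represents-unique Y≈ (∪-represents R≈)) ⟩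
      ∣ X ∪ R ∣      ≤⟨ ∣p∪q∣≤∣p∣+∣q∣ X R ⟩
      ∣ X ∣ + ∣ R ∣  ≤⟨ +-monoʳ-≤ ∣ X ∣ (bounded (qs t) (x∈B , t , t<q , inj₁ refl) R R≈) ⟩
      ∣ X ∣ + D      ∎
      where
      open ≤-Reasoning
      R : Subset n
      R = proj₁ (AncF-representable q (qs t))
      R≈ : Represents R (AncF q (qs t))
      R≈ = proj₂ (AncF-representable q (qs t))

    noCandidate⇒ancestor-closed : ∀ {X} → (∀ s → ¬ Candidate q X s) →
      ∀ {v w} → Star (EdgeKGB q) v w → w ∈ X → v ∈ X
    noCandidate⇒ancestor-closed noCandidate ε w∈X = w∈X
    noCandidate⇒ancestor-closed {X} noCandidate {v} ((t , t<q , refl , v∈B , y∈B , y∈Γv) ◅ y↝w) w∈X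
      with v ∈? X
    ... | yes v∈X = v∈X
    ... | no  v∉X = ⊥-elim (noCandidate t (t<q , v∈B , v∉X , _ , y∈Γv , y∈B ,
                                           noCandidate⇒ancestor-closed noCandidate y↝w w∈X))

    module _ {u H A} (closureSeq : IsClosureSeq q u H A) where

      closureSeq-induction : (I : ℕ → Subset n → Set) → I 0 (A 0) →
        (∀ i {X Y} → ClosureStep q X Y → I i X → I (suc i) Y) →
        ∀ i → i ≤ H → I i (A i)
      closureSeq-induction I base step zero    _     = base
      closureSeq-induction I base step (suc i) i<H =
        step i (proj₁ (proj₂ closureSeq) i i<H) (closureSeq-induction I base step i (<⇒≤ i<H))

      A₀≡⁅u⁆ : A 0 ≡ ⁅ u ⁆
      A₀≡⁅u⁆ = Represents-unique (proj₁ closureSeq) (λ v → x∈⁅y⁆⇔x≡y)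

      closureSeq-∋ : u ∈ A H
      closureSeq-∋ = closureSeq-induction (λ _ X → u ∈ X)
        (from (proj₁ closureSeq u) refl) (λ _ step → closureStep-⊆ step) H ≤-refl

      closureSeq-⊆Anc : u ∈ B → ∀ {v} → v ∈ A H → Anc q u v
      closureSeq-⊆Anc u∈B = closureSeq-induction (λ _ X → ∀ {v} → v ∈ X → Anc q u v)
        base (λ _ → closureStep-preserves-Anc) H ≤-refl
        where
        base : ∀ {v} → v ∈ A 0 → Anc q u v
        base {v} v∈A₀ with to (proj₁ closureSeq v) v∈A₀
        ... | refl = u∈B , ε

      closureSeq-represents-Anc : u ∈ B → Represents (A H) (Anc q u)
      closureSeq-represents-Anc u∈B v = mk⇔ (closureSeq-⊆Anc u∈B)
        (λ (_ , v↝u) → noCandidate⇒ancestor-closed (proj₂ (proj₂ closureSeq)) v↝u closureSeq-∋)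

      closureSeq-∣∣≤ : ∀ {D} → AncF-boundedBy q D → ∣ A H ∣ ≤ 1 + H * D
      closureSeq-∣∣≤ {D} bounded = closureSeq-induction (λ i X → ∣ X ∣ ≤ 1 + i * D)
        (≤-reflexive (trans (cong ∣_∣ A₀≡⁅u⁆) (∣⁅x⁆∣≡1 u))) step H ≤-refl
        where
        step : ∀ i {X Y} → ClosureStep q X Y → ∣ X ∣ ≤ 1 + i * D → ∣ Y ∣ ≤ 1 + suc i * D
        step i {X} {Y} X→Y ∣X∣≤ = begin
          ∣ Y ∣             ≤⟨ closureStep-∣∣≤ bounded X→Y ⟩
          ∣ X ∣ + D         ≤⟨ +-monoˡ-≤ D ∣X∣≤ ⟩
          1 + i * D + D     ≡⟨ cong suc (+-comm (i * D) D) ⟩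
          1 + suc i * D     ∎
          where open ≤-Reasoning

1+m*n≤[m+1]*n : ∀ m {n} → 1 ≤ n → 1 + m * n ≤ (m + 1) * n
1+m*n≤[m+1]*n m {n} 1≤n = begin
  1 + m * n      ≡⟨ +-comm 1 (m * n) ⟩
  m * n + 1      ≤⟨ +-monoʳ-≤ (m * n) 1≤n ⟩
  m * n + n      ≡⟨ cong (m * n +_) (sym (*-identityˡ n)) ⟩
  m * n + 1 * n  ≡⟨ sym (*-distribʳ-+ n m 1) ⟩
  (m + 1) * n    ∎
  where open ≤-Reasoning

lemma4p6 : ∀ {n : ℕ} (G : Digraph n) → InSupportPerm G →
    ∀ {T : ℕ} (qs : Fin T → Fin n) → Injective _≡_ _≡_ qs →
    ∀ (q : ℕ) → q ≤ T → ∀ (u : Fin n) → KG.InKGB G qs q u →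
    ∀ (H : ℕ) (A : ℕ → Subset n) → KG.IsClosureSeq G qs q u H A →
    Represents (A H) (KG.Anc G qs q u) ×
    (∀ (D : ℕ) → 1 ≤ D →
      (∀ (v : Fin n) → KG.InKGB G qs q v →
        ∀ (S : Subset n) → Represents S (KG.AncF G qs q v) → ∣ S ∣ ≤ D) →
      ∀ (S : Subset n) → Represents S (KG.Anc G qs q u) →
        (∣ S ∣ ≤ 1 + H * D) × (1 + H * D ≤ (H + 1) * D))
lemma4p6 G _ qs _ q _ u (u∈B , _) H A closureSeq = A≈Anc , λ D 1≤D bounded S S≈Anc →
    ≤-trans (≤-reflexive (cong ∣_∣ (Represents-unique S≈Anc A≈Anc)))
            (closureSeq-∣∣≤ G qs closureSeq bounded)
  , 1+m*n≤[m+1]*n H 1≤D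
  where
  A≈Anc : Represents (A H) (KG.Anc G qs q u)
  A≈Anc = closureSeq-represents-Anc G qs closureSeq u∈B
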